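{- Let $B$ be a triangular block of some plane graph. If $B$ is $\Theta_6^1$-free, then either $B$ has at most $5$ vertices or $B$ is isomorphic to the graph $B_6$ with vertex set $\{x_1,\dots,x_6\}$ and the nine edges $x_1x_2,x_2x_3,x_3x_4,x_4x_5,x_5x_6,x_6x_1,x_1x_3,x_3x_5,x_5x_1$ (a triangle $x_1x_3x_5$ with a further triangle attached along each of its three edges). If $B$ is $\Theta_6^2$-free, then $B$ has at most $5$ vertices.
   Context: All graphs are finite, simple plane graphs. $\Theta_6^1$ is the $6$-cycle $v_1\dots v_6$ plus the chord $v_1v_4$; $\Theta_6^2$ is the $6$-cycle $v_1\dots v_6$ plus the chord $v_1v_3$; "$H$-free" means not containing $H$ as a subgraph. A $3$-face is a face whose boundary has length $3$; two faces are adjacent if they share a boundary edge. Triangular blocks: let $G$ be a plane graph and $e\in E(G)$ incident to some $3$-face $f_e$. Let $\Omega_e$ be a set of faces of $G$ of smallest size such that (1) $f_e\in\Omega_e$, and (2) whenever a $3$-face $f'$ of $G$ is adjacent to some face $f''\in\Omega_e$, then $f'\in\Omega_e$. The subgraph $B_e$ of $G$ induced by the union of the boundary edge sets of the faces in $\Omega_e$ is called a triangular block. -}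

module Defs where

open import Data.Nat using (ℕ; zero; suc; _+_)
open import Data.Fin using (Fin; #_)
open import Data.Product using (Σ; ∃; _×_; _,_)
open import Data.Sum using (_⊎_)
open import Data.List using (List; []; _∷_)
open import Data.List.Membership.Propositional using (_∈_)
open import Data.Empty using (⊥)
open import Relation.Nullary using (¬_)
open import Relation.Binary.PropositionalEquality using (_≡_; _≢_)
open import Function.Definitions using (Injective)

iter : {A : Set} → (A → A) → ℕ → A → A
iter f zero    x = x
iter f (suc k) x = f (iter f k x)

data Reach {D : ℕ} (α σ : Fin D → Fin D) (d : Fin D) : Fin D → Set where
  here  : Reach α σ d d
  stepα : ∀ {d'} → Reach α σ d d' → Reach α σ d (α d')
  stepσ : ∀ {d'} → Reach α σ d d' → Reach α σ d (σ d')

-- A connected simple plane graph, encoded combinatorially as a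
-- rotation system (combinatorial map) of genus 0.
--   * vertices: Fin nV, edges: nE, darts (half-edges): Fin (nE + nE)
--   * α : the fixed-point-free involution pairing the two darts of an edge
--   * σ : the rotation (a permutation whose orbits are the darts at a vertex)
--   * faces: the orbits of φ = σ ∘ α, labelled surjectively by Fin nF
--   * planarity: Euler's formula nV - nE + nF = 2.

record PlaneGraph : Set where
  field
    nV nE nF : ℕ
    vert     : Fin (nE + nE) → Fin nV
    α        : Fin (nE + nE) → Fin (nE + nE)
    σ        : Fin (nE + nE) → Fin (nE + nE)
    σ⁻       : Fin (nE + nE) → Fin (nE + nE)
    α-invol  : ∀ d → α (α d) ≡ d
    α-nofix  : ∀ d → α d ≢ d
    σ-inv₁   : ∀ d → σ (σ⁻ d) ≡ d
    σ-inv₂   : ∀ d → σ⁻ (σ d) ≡ d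
    vert-σ   : ∀ d → vert (σ d) ≡ vert d
    vert-orb : ∀ d d' → vert d ≡ vert d' → ∃ λ k → iter σ k d ≡ d'
    vert-onto : ∀ v → ∃ λ d → vert d ≡ v
    no-loop  : ∀ d → vert (α d) ≢ vert d
    no-multi : ∀ d d' → vert d ≡ vert d' → vert (α d) ≡ vert (α d') → d ≡ d'
    connected : ∀ d d' → Reach α σ d d'
    face     : Fin (nE + nE) → Fin nF
    face-φ   : ∀ d → face (σ (α d)) ≡ face d
    face-orb : ∀ d d' → face d ≡ face d' → ∃ λ k → iter (λ x → σ (α x)) k d ≡ d'
    face-onto : ∀ f → ∃ λ d → face d ≡ f
    euler    : nV + nF ≡ nE + 2

module _ (G : PlaneGraph) where
  open PlaneGraph G

  Dart : Set
  Dart = Fin (nE + nE)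

  Vertex : Set
  Vertex = Fin nV

  φ : Dart → Dart
  φ d = σ (α d)

  Is3Face : Dart → Set
  Is3Face d = (φ (φ (φ d)) ≡ d) × (φ d ≢ d)

  -- Ω d₀ : the least set of faces containing the face of d₀ and closed under
  -- adding 3-faces adjacent (sharing a boundary edge) to a face of the set.
  -- Faces are represented by their darts; InΩ d₀ d means "the face of d is in Ω".
  data InΩ (d₀ : Dart) : Dart → Set where
    base : InΩ d₀ d₀
    next : ∀ {d} → InΩ d₀ d → InΩ d₀ (φ d)
    adj  : ∀ {d} → InΩ d₀ d → Is3Face (α d) → InΩ d₀ (α d)

  -- The triangular block B_e: the subgraph formed by the boundary edges of
  -- the faces in Ω (with their end vertices).
  BVert : Dart → Vertex → Set
  BVert d₀ v = ∃ λ d → InΩ d₀ d × vert d ≡ v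

  BAdj : Dart → Vertex → Vertex → Set
  BAdj d₀ u v = ∃ λ d → (InΩ d₀ d ⊎ InΩ d₀ (α d)) × (vert d ≡ u) × (vert (α d) ≡ v)

EdgeRel : List (Fin 6 × Fin 6) → Fin 6 → Fin 6 → Set
EdgeRel es i j = ((i , j) ∈ es) ⊎ ((j , i) ∈ es)

Θ₆¹ : Fin 6 → Fin 6 → Set
Θ₆¹ = EdgeRel ((# 0 , # 1) ∷ (# 1 , # 2) ∷ (# 2 , # 3) ∷ (# 3 , # 4) ∷ (# 4 , # 5) ∷ (# 5 , # 0)
               ∷ (# 0 , # 3) ∷ [])

Θ₆² : Fin 6 → Fin 6 → Set
Θ₆² = EdgeRel ((# 0 , # 1) ∷ (# 1 , # 2) ∷ (# 2 , # 3) ∷ (# 3 , # 4) ∷ (# 4 , # 5) ∷ (# 5 , # 0)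
               ∷ (# 0 , # 2) ∷ [])

B₆ : Fin 6 → Fin 6 → Set
B₆ = EdgeRel ((# 0 , # 1) ∷ (# 1 , # 2) ∷ (# 2 , # 3) ∷ (# 3 , # 4) ∷ (# 4 , # 5) ∷ (# 5 , # 0)
              ∷ (# 0 , # 2) ∷ (# 2 , # 4) ∷ (# 4 , # 0) ∷ [])

AtMost5Vertices : {n : ℕ} → (Fin n → Set) → Set
AtMost5Vertices {n} V = (f : Fin 6 → Fin n) → Injective _≡_ _≡_ f → (∀ i → V (f i)) → ⊥

ContainsSub : {n : ℕ} → (Fin n → Set) → (Fin n → Fin n → Set) → (Fin 6 → Fin 6 → Set) → Set
ContainsSub {n} V A H =
  Σ (Fin 6 → Fin n) λ f → Injective _≡_ _≡_ f × (∀ i → V (f i)) × (∀ i j → H i j → A (f i) (f j))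

Free : {n : ℕ} → (Fin n → Set) → (Fin n → Fin n → Set) → (Fin 6 → Fin 6 → Set) → Set
Free V A H = ¬ ContainsSub V A H

IsoTo : {n : ℕ} → (Fin n → Set) → (Fin n → Fin n → Set) → (Fin 6 → Fin 6 → Set) → Set
IsoTo {n} V A H =
  Σ (Fin 6 → Fin n) λ f → Injective _≡_ _≡_ f × (∀ i → V (f i))
    × (∀ v → V v → ∃ λ i → f i ≡ v)
    × (∀ i j → (H i j → A (f i) (f j)) × (A (f i) (f j) → H i j))

-- Every face of Ω is a triangle and Ω is connected through shared edges, so the block can be
-- explored from f_e one triangle at a time: examine a side of an edge of the triangles found so
-- far; either no face of Ω lies on that side, or a triangle of Ω does, whose third corner is a new
-- vertex or one of the vertices already found.  Since each side of an edge lies on exactly one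
-- face, the possible explorations form a finite tree of configurations of labelled triangles.
-- Along every branch, a configuration containing both Θ₆² and Θ₆¹ is reached, or else every side
-- gets examined; then the configuration is the whole block, and it has at most five vertices or
-- is B₆ (which contains Θ₆²).  The tree is checked by evaluation.

module Submission where

open import Defs
open import Data.Bool using (Bool; true; false; not; _∧_; _∨_; if_then_else_)
open import Data.Bool.ListAction using (all)
open import Data.Bool.Properties using (T-≡)
open import Data.Empty using (⊥; ⊥-elim)
open import Data.Fin using (Fin; zero; suc; #_)
open import Data.Fin.Properties using (_≟_; all?; any?; <⇒notInjective)
open import Data.List using (List; []; _∷_; _++_; map; concatMap; allFin; filterᵇ; head)
open import Data.List.Membership.Propositional using (_∈_; _∉_; find)
import Data.List.Membership.DecPropositional as DecMembership
open import Data.List.Relation.Unary.All as All using (All; []; _∷_)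
open import Data.List.Relation.Unary.All.Properties using (¬All⇒Any¬; map⁺)
open import Data.List.Relation.Unary.Any using (here; there)
open import Data.Maybe using (Maybe; just; nothing; is-just; to-witness-T; _>>=_; _<∣>_)
import Data.Maybe as Maybe
open import Data.Nat using (ℕ; zero; suc; _≤_; _≤?_; s≤s)
open import Data.Product using (∃; ∃₂; _×_; _,_; proj₁; proj₂)
open import Data.Product.Properties using (≡-dec)
open import Data.Sum using (_⊎_; inj₁; inj₂)
open import Data.Vec as Vec using (Vec; [_]; lookup; tabulate)
open import Data.Vec.Functional using () renaming ([] to []ᶠ; _∷_ to _∷ᶠ_)
open import Function using (_∘_)
open import Function.Bundles using (Equivalence)
open import Function.Definitions using (Injective)
open import Relation.Nullary using (Dec; yes; no; does; ¬_; ¬?)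
open import Relation.Nullary.Decidable using (_×-dec_; _⊎-dec_; _→-dec_; map′; T?; isYes; toWitness; dec⇒maybe)
open import Relation.Unary using (Decidable)
open import Relation.Binary.PropositionalEquality using (_≡_; _≢_; refl; sym; trans; cong; subst)

∷-injective : ∀ {A : Set} {k} {ι : Fin k → A} {w} → Injective _≡_ _≡_ ι → (∀ x → ι x ≢ w) →
              Injective _≡_ _≡_ (w ∷ᶠ ι)
∷-injective ι-inj fresh {zero}  {zero}  eq = refl
∷-injective ι-inj fresh {zero}  {suc y} eq = ⊥-elim (fresh y (sym eq))
∷-injective ι-inj fresh {suc x} {zero}  eq = ⊥-elim (fresh x eq)
∷-injective ι-inj fresh {suc x} {suc y} eq = cong suc (ι-inj eq)

injective? : ∀ {m n} (g : Fin m → Fin n) → Dec (Injective _≡_ _≡_ g)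
injective? g = map′ (λ inj {i} {j} → inj i j) (λ inj i j → inj {i} {j})
                    (all? λ i → all? λ j → (g i ≟ g j) →-dec (i ≟ j))

∧-true : ∀ {x y} → x ∧ y ≡ true → x ≡ true × y ≡ true
∧-true {true}  eq = refl , eq
∧-true {false} ()

allWhen : ∀ {k} {P : Fin k → Set} → Decidable P → (Fin k → Bool) → Bool
allWhen P? s = isYes (all? λ i → T? (if isYes (P? i) then s i else true))

allWhen-sound : ∀ {k} {P : Fin k → Set} (P? : Decidable P) (s : Fin k → Bool) →
                allWhen P? s ≡ true → ∀ i → P i → s i ≡ true
allWhen-sound P? s ok i p with P? i | toWitness (Equivalence.from T-≡ ok) i
... | yes _ | s-ok = Equivalence.to T-≡ s-ok
... | no ¬p | _    = ⊥-elim (¬p p)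

-- Configurations of labelled triangles

-- A triangle is given by its corners in the order of its boundary walk; the arcs of a list of
-- triangles are the directed edges of these walks.
Triple Arc : ℕ → Set
Triple k = Fin k × Fin k × Fin k
Arc k = Fin k × Fin k

hexagon : List (Arc 6)
hexagon = (# 0 , # 1) ∷ (# 1 , # 2) ∷ (# 2 , # 3) ∷ (# 3 , # 4) ∷ (# 4 , # 5) ∷ (# 5 , # 0) ∷ []

Θ₆¹-arcs Θ₆²-arcs B₆-arcs : List (Arc 6)
Θ₆¹-arcs = hexagon ++ (# 0 , # 3) ∷ []
Θ₆²-arcs = hexagon ++ (# 0 , # 2) ∷ []
B₆-arcs  = hexagon ++ (# 0 , # 2) ∷ (# 2 , # 4) ∷ (# 4 , # 0) ∷ []

hexagon-spans : ∀ chords i → ∃ λ j → (i , j) ∈ hexagon ++ chords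
hexagon-spans _ zero                               = # 1 , here refl
hexagon-spans _ (suc zero)                         = # 2 , there (here refl)
hexagon-spans _ (suc (suc zero))                   = # 3 , there (there (here refl))
hexagon-spans _ (suc (suc (suc zero)))             = # 4 , there (there (there (here refl)))
hexagon-spans _ (suc (suc (suc (suc zero))))       = # 5 , there (there (there (there (here refl))))
hexagon-spans _ (suc (suc (suc (suc (suc zero))))) = # 0 , there (there (there (there (there (here refl)))))

_∈ₐ?_ : ∀ {k} (e : Arc k) (es : List (Arc k)) → Dec (e ∈ es)
_∈ₐ?_ = DecMembership._∈?_ (≡-dec _≟_ _≟_)

module _ {k : ℕ} where

  arcs : List (Triple k) → List (Arc k)
  arcs []                = []
  arcs ((a , b , c) ∷ Δ) = (a , b) ∷ (b , c) ∷ (c , a) ∷ arcs Δ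

  Adjacent : List (Triple k) → Fin k → Fin k → Set
  Adjacent Δ x y = (x , y) ∈ arcs Δ ⊎ (y , x) ∈ arcs Δ

  adjacent? : ∀ Δ x y → Dec (Adjacent Δ x y)
  adjacent? Δ x y = ((x , y) ∈ₐ? arcs Δ) ⊎-dec ((y , x) ∈ₐ? arcs Δ)

  Embeds : List (Triple k) → List (Arc 6) → (Fin 6 → Fin k) → Set
  Embeds Δ H g = Injective _≡_ _≡_ g × All (λ e → Adjacent Δ (g (proj₁ e)) (g (proj₂ e))) H

  embeds? : ∀ Δ H g → Dec (Embeds Δ H g)
  embeds? Δ H g = injective? g ×-dec All.all? (λ e → adjacent? Δ (g (proj₁ e)) (g (proj₂ e))) H

  IsomorphicVia : List (Triple k) → (Fin 6 → Fin k) → Set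
  IsomorphicVia Δ g = Embeds Δ B₆-arcs g × (∀ x → ∃ λ i → g i ≡ x)
                    × (∀ i j → Adjacent Δ (g i) (g j) → EdgeRel B₆-arcs i j)

  isomorphicVia? : ∀ Δ g → Dec (IsomorphicVia Δ g)
  isomorphicVia? Δ g =
    embeds? Δ B₆-arcs g
    ×-dec all? (λ x → any? λ i → g i ≟ x)
    ×-dec all? (λ i → all? λ j →
             adjacent? Δ (g i) (g j) →-dec ((i , j) ∈ₐ? B₆-arcs ⊎-dec (j , i) ∈ₐ? B₆-arcs))

  adjacency : List (Triple k) → Vec (Vec Bool k) k
  adjacency Δ = tabulate λ x → tabulate λ y → does (adjacent? Δ x y)

  occurs : ∀ {n} → Fin k → Vec (Fin k) n → Bool
  occurs y Vec.[]       = false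
  occurs y (x Vec.∷ xs) = does (y ≟ x) ∨ occurs y xs

  simplePaths : Vec (Vec Bool k) k → (n : ℕ) → List (Vec (Fin k) (suc n))
  simplePaths M zero    = map [_] (allFin k)
  simplePaths M (suc n) = concatMap extend (simplePaths M n)
    where
    extend : Vec (Fin k) (suc n) → List (Vec (Fin k) (suc (suc n)))
    extend p = map (Vec._∷ p) (filterᵇ (λ y → lookup (lookup M (Vec.head p)) y ∧ not (occurs y p))
                                        (allFin k))

  matches : Vec (Vec Bool k) k → List (Arc 6) → Vec (Fin k) 6 → Bool
  matches M H p = all (λ e → lookup (lookup M (lookup p (proj₁ e))) (lookup p (proj₂ e))) H

  -- An unverified heuristic, trying simple paths as images of the hexagon; embedding? and
  -- isomorphism? check what it proposes.
  candidate : List (Triple k) → List (Arc 6) → Maybe (Fin 6 → Fin k)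
  candidate Δ H = Maybe.map lookup (head (filterᵇ (matches M H) (simplePaths M 5)))
    where M = adjacency Δ

  embedding? : ∀ Δ H → Maybe (∃ (Embeds Δ H))
  embedding? Δ H = candidate Δ H >>= λ g → Maybe.map (g ,_) (dec⇒maybe (embeds? Δ H g))

  isomorphism? : ∀ Δ → Maybe (∃ (IsomorphicVia Δ))
  isomorphism? Δ = candidate Δ B₆-arcs >>= λ g → Maybe.map (g ,_) (dec⇒maybe (isomorphicVia? Δ g))

  Thetas : List (Triple k) → Set
  Thetas Δ = ∃ (Embeds Δ Θ₆²-arcs) × ∃ (Embeds Δ Θ₆¹-arcs)

  thetas? : ∀ Δ → Maybe (Thetas Δ)
  thetas? Δ = if isYes (6 ≤? k) then Maybe.zip (embedding? Δ Θ₆²-arcs) (embedding? Δ Θ₆¹-arcs) else nothing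

  SmallOrB₆ : List (Triple k) → Set
  SmallOrB₆ Δ = k ≤ 5 ⊎ ∃ (Embeds Δ Θ₆²-arcs) × ∃ (IsomorphicVia Δ)

  smallOrB₆? : ∀ Δ → Maybe (SmallOrB₆ Δ)
  smallOrB₆? Δ = Maybe.map inj₁ (dec⇒maybe (k ≤? 5))
             <∣> Maybe.map inj₂ (Maybe.zip (embedding? Δ Θ₆²-arcs) (isomorphism? Δ))

-- C is the list of arcs beyond which no face of Ω lies.
module _ {k : ℕ} where

  Settled : List (Triple k) → List (Arc k) → Arc k → Set
  Settled Δ C (a , b) = (b , a) ∈ arcs Δ ⊎ (a , b) ∈ C

  settled? : ∀ Δ C e → Dec (Settled Δ C e)
  settled? Δ C (a , b) = ((b , a) ∈ₐ? arcs Δ) ⊎-dec ((a , b) ∈ₐ? C)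

  data Frontier (Δ : List (Triple k)) (C : List (Arc k)) : Set where
    settled   : All (Settled Δ C) (arcs Δ) → Frontier Δ C
    undecided : ∀ a b → (a , b) ∈ arcs Δ → (b , a) ∉ arcs Δ → Frontier Δ C

  frontier : ∀ Δ C → Frontier Δ C
  frontier Δ C with All.all? (settled? Δ C) (arcs Δ)
  ... | yes done = settled done
  ... | no ¬done with find (¬All⇒Any¬ (settled? Δ C) (arcs Δ) ¬done)
  ...   | (a , b) , ab∈ , unsettled = undecided a b ab∈ (unsettled ∘ inj₁)

  Attachable : List (Triple k) → Fin k → Fin k → Fin k → Set
  Attachable Δ a b i = ¬ (i ≡ a ⊎ i ≡ b ⊎ (a , i) ∈ arcs Δ ⊎ (i , b) ∈ arcs Δ)

  attachable? : ∀ Δ a b i → Dec (Attachable Δ a b i)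
  attachable? Δ a b i =
    ¬? ((i ≟ a) ⊎-dec (i ≟ b) ⊎-dec ((a , i) ∈ₐ? arcs Δ) ⊎-dec ((i , b) ∈ₐ? arcs Δ))

shift : ∀ {k} → Triple k → Triple (suc k)
shift (a , b , c) = suc a , suc b , suc c

shiftArc : ∀ {k} → Arc k → Arc (suc k)
shiftArc (a , b) = suc a , suc b

-- A new corner gets the label zero and the old labels move up by one.  Running out of fuel
-- counts as failure.
mutual
  search : ℕ → (k : ℕ) → List (Triple k) → List (Arc k) → Bool
  search zero    k Δ C = false
  search (suc n) k Δ C = is-just (thetas? Δ) ∨ explore n k Δ C (frontier Δ C)

  explore : ℕ → (k : ℕ) (Δ : List (Triple k)) (C : List (Arc k)) → Frontier Δ C → Bool
  explore n k Δ C (settled _)         = is-just (smallOrB₆? Δ)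
  explore n k Δ C (undecided a b _ _) =
    search n k Δ ((a , b) ∷ C)
    ∧ search n (suc k) ((suc b , suc a , zero) ∷ map shift Δ) (map shiftArc C)
    ∧ allWhen (attachable? Δ a b) (λ i → search n k ((b , a , i) ∷ Δ) C)

triangle₀ : List (Triple 3)
triangle₀ = (# 0 , # 1 , # 2) ∷ []

-- The evaluation visits about 1350 configurations; the deepest branch takes 9 steps.
search-succeeds : search 10 3 triangle₀ [] ≡ true
search-succeeds = refl

-- Triangles of Ω

module PlaneGraphProperties (G : PlaneGraph) where
  open PlaneGraph G

  α-injective : ∀ {x y} → α x ≡ α y → x ≡ y
  α-injective {x} {y} eq = trans (sym (α-invol x)) (trans (cong α eq) (α-invol y))

  σ-injective : ∀ {x y} → σ x ≡ σ y → x ≡ y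
  σ-injective {x} {y} eq = trans (sym (σ-inv₂ x)) (trans (cong σ⁻ eq) (σ-inv₂ y))

  φ-injective : ∀ {x y} → φ G x ≡ φ G y → x ≡ y
  φ-injective = α-injective ∘ σ-injective

  vert-α : ∀ d → vert (α d) ≡ vert (φ G d)
  vert-α d = sym (vert-σ (α d))

  is3Face? : ∀ d → Dec (Is3Face G d)
  is3Face? d = (φ G (φ G (φ G d)) ≟ d) ×-dec ¬? (φ G d ≟ d)

  Is3Face-φ : ∀ {d} → Is3Face G d → Is3Face G (φ G d)
  Is3Face-φ (φ³≡id , φ≢id) = cong (φ G) φ³≡id , φ≢id ∘ φ-injective

module BlockProperties (G : PlaneGraph) (d₀ : Dart G) where
  open PlaneGraph G

  BAdj-sym : ∀ {u v} → BAdj G d₀ u v → BAdj G d₀ v u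
  BAdj-sym (d , inj₁ p , d-tail , d-head) =
    α d , inj₂ (subst (InΩ G d₀) (sym (α-invol d)) p) , d-head , trans (cong vert (α-invol d)) d-tail
  BAdj-sym (d , inj₂ p , d-tail , d-head) =
    α d , inj₁ p , d-head , trans (cong vert (α-invol d)) d-tail

  BAdj⇒BVert : ∀ {u v} → BAdj G d₀ u v → BVert G d₀ u
  BAdj⇒BVert (d , inj₁ p , d-tail , _) = d , p , d-tail
  BAdj⇒BVert (d , inj₂ p , d-tail , _) =
    φ G (α d) , next p , trans (vert-σ _) (trans (cong vert (α-invol d)) d-tail)

module _ (G : PlaneGraph) (d₀ : Dart G) (d₀-triangular : Is3Face G d₀) where
  open PlaneGraph G
  open PlaneGraphProperties G
  open BlockProperties G d₀

  InΩ⇒Is3Face : ∀ {d} → InΩ G d₀ d → Is3Face G d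
  InΩ⇒Is3Face base      = d₀-triangular
  InΩ⇒Is3Face (next p)  = Is3Face-φ (InΩ⇒Is3Face p)
  InΩ⇒Is3Face (adj _ t) = t

  record Triangle (a b c : Vertex G) : Set where
    constructor triangle
    field
      dart    : Dart G
      inΩ     : InΩ G d₀ dart
      corner₁ : vert dart ≡ a
      corner₂ : vert (φ G dart) ≡ b
      corner₃ : vert (φ G (φ G dart)) ≡ c

    head-corner : vert (α dart) ≡ b
    head-corner = trans (vert-α dart) corner₂

  open Triangle

  rotate : ∀ {a b c} → Triangle a b c → Triangle b c a
  rotate t = triangle (φ G (dart t)) (next (inΩ t)) (corner₂ t) (corner₃ t)
                      (trans (cong vert (proj₁ (InΩ⇒Is3Face (inΩ t)))) (corner₁ t))

  corners-distinct : ∀ {a b c} → Triangle a b c → a ≢ b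
  corners-distinct t a≡b =
    no-loop (dart t) (trans (head-corner t) (trans (sym a≡b) (sym (corner₁ t))))

  NoΩDart : Vertex G → Vertex G → Set
  NoΩDart u v = ∀ {d} → InΩ G d₀ d → vert d ≡ u → vert (α d) ≡ v → ⊥

  across : ∀ {a b c} → Triangle a b c → NoΩDart b a ⊎ ∃ (Triangle b a)
  across t with is3Face? (α (dart t))
  ... | yes t′ = inj₂ (_ , triangle (α (dart t)) (adj (inΩ t) t′) (head-corner t) a-corner refl)
    where a-corner = trans (vert-σ _) (trans (cong vert (α-invol _)) (corner₁ t))
  ... | no ¬t′ = inj₁ λ {d} p d-tail d-head →
    ¬t′ (subst (Is3Face G) (no-multi d (α (dart t)) (trans d-tail (sym (head-corner t)))
                             (trans d-head (sym (trans (cong vert (α-invol _)) (corner₁ t)))))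
               (InΩ⇒Is3Face p))

  module Labelled {k} (ι : Fin k → Vertex G) where

    Realizes : Triple k → Set
    Realizes (a , b , c) = Triangle (ι a) (ι b) (ι c)

    Covers : List (Triple k) → Dart G → Set
    Covers Δ d = ∃₂ λ x y → (x , y) ∈ arcs Δ × ι x ≡ vert d × ι y ≡ vert (α d)

    Closed : List (Triple k) → Set
    Closed Δ = ∀ {a b} → (a , b) ∈ arcs Δ → (b , a) ∈ arcs Δ ⊎ NoΩDart (ι b) (ι a)

    arc-triangle : ∀ {Δ x y} → All Realizes Δ → (x , y) ∈ arcs Δ →
                   ∃ λ z → (y , z) ∈ arcs Δ × Triangle (ι x) (ι y) (ι z)
    arc-triangle (t ∷ ts) (here refl)                 = _ , there (here refl) , t
    arc-triangle (t ∷ ts) (there (here refl))         = _ , there (there (here refl)) , rotate t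
    arc-triangle (t ∷ ts) (there (there (here refl))) = _ , here refl , rotate (rotate t)
    arc-triangle (t ∷ ts) (there (there (there m))) with arc-triangle ts m
    ... | z , m′ , t′ = z , there (there (there m′)) , t′

    covering : ∀ {Δ x y c} (t : Triangle (ι x) (ι y) c) → (x , y) ∈ arcs Δ → Covers Δ (dart t)
    covering t m = _ , _ , m , sym (corner₁ t) , sym (head-corner t)

    covered-arc : ∀ {Δ x y c} → Injective _≡_ _≡_ ι → (t : Triangle (ι x) (ι y) c) →
                  Covers Δ (dart t) → (x , y) ∈ arcs Δ
    covered-arc ι-inj t (_ , _ , m , x-tail , y-head)
      with ι-inj (trans x-tail (corner₁ t)) | ι-inj (trans y-head (head-corner t))
    ... | refl | refl = m

    covers-φ : ∀ {Δ d} → All Realizes Δ → Covers Δ d → Covers Δ (φ G d)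
    covers-φ {d = d} ts (x , y , m , x-tail , y-head) with arc-triangle ts m
    ... | z , m′ , t with no-multi (dart t) d (trans (corner₁ t) x-tail) (trans (head-corner t) y-head)
    ...   | refl = covering (rotate t) m′

    covers-unrotate : ∀ {Δ a b c} → All Realizes Δ → (t : Triangle a b c) →
                      Covers Δ (dart (rotate t)) → Covers Δ (dart t)
    covers-unrotate ts t c =
      subst (Covers _) (proj₁ (InΩ⇒Is3Face (inΩ t))) (covers-φ ts (covers-φ ts c))

    Ω-covered : ∀ {Δ d} → All Realizes Δ → Covers Δ d₀ → Closed Δ → InΩ G d₀ d → Covers Δ d
    Ω-covered ts c₀ cl base     = c₀
    Ω-covered ts c₀ cl (next p) = covers-φ ts (Ω-covered ts c₀ cl p)
    Ω-covered ts c₀ cl (adj {d} p t) with Ω-covered ts c₀ cl p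
    ... | a , b , m , a-tail , b-head with cl m
    ...   | inj₁ m′   = b , a , m′ , b-head , trans a-tail (sym (cong vert (α-invol d)))
    ...   | inj₂ none = ⊥-elim (none (adj p t) (sym b-head) (trans (cong vert (α-invol d)) (sym a-tail)))

    arc⇒BAdj : ∀ {Δ x y} → All Realizes Δ → (x , y) ∈ arcs Δ → BAdj G d₀ (ι x) (ι y)
    arc⇒BAdj ts m with arc-triangle ts m
    ... | _ , _ , t = dart t , inj₁ (inΩ t) , corner₁ t , head-corner t

    adjacent⇒BAdj : ∀ {Δ x y} → All Realizes Δ → Adjacent Δ x y → BAdj G d₀ (ι x) (ι y)
    adjacent⇒BAdj ts (inj₁ m) = arc⇒BAdj ts m
    adjacent⇒BAdj ts (inj₂ m) = BAdj-sym (arc⇒BAdj ts m)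

    module Closure {Δ} (ts : All Realizes Δ) (c₀ : Covers Δ d₀) (cl : Closed Δ) where

      block-vertex : ∀ {v} → BVert G d₀ v → ∃ λ x → ι x ≡ v
      block-vertex (d , p , d-tail) with Ω-covered ts c₀ cl p
      ... | x , _ , _ , x-tail , _ = x , trans x-tail d-tail

      block-edge : ∀ {u v} → BAdj G d₀ u v → ∃₂ λ x y → Adjacent Δ x y × ι x ≡ u × ι y ≡ v
      block-edge (d , inj₁ p , d-tail , d-head) with Ω-covered ts c₀ cl p
      ... | x , y , m , x-tail , y-head = x , y , inj₁ m , trans x-tail d-tail , trans y-head d-head
      block-edge (d , inj₂ p , d-tail , d-head) with Ω-covered ts c₀ cl p
      ... | x , y , m , x-tail , y-head =
        y , x , inj₂ m , trans y-head (trans (cong vert (α-invol d)) d-tail) , trans x-tail d-head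

      few-labels : k ≤ 5 → AtMost5Vertices (BVert G d₀)
      few-labels k≤5 f f-inj f-in = <⇒notInjective (s≤s k≤5) label-inj
        where
        label : Fin 6 → Fin k
        label i = proj₁ (block-vertex (f-in i))
        label-inj : Injective _≡_ _≡_ label
        label-inj {i} {j} eq = f-inj (trans (sym (proj₂ (block-vertex (f-in i))))
                                    (trans (cong ι eq) (proj₂ (block-vertex (f-in j)))))

    embedded-edge : ∀ {Δ H} {g : Fin 6 → Fin k} → All Realizes Δ →
                    All (λ e → Adjacent Δ (g (proj₁ e)) (g (proj₂ e))) H →
                    ∀ i j → EdgeRel H i j → BAdj G d₀ (ι (g i)) (ι (g j))
    embedded-edge ts adjacent i j (inj₁ m) = adjacent⇒BAdj ts (All.lookup adjacent m)
    embedded-edge ts adjacent i j (inj₂ m) = BAdj-sym (adjacent⇒BAdj ts (All.lookup adjacent m))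

    embedded-vertex : ∀ {Δ H} {g : Fin 6 → Fin k} → All Realizes Δ → (∀ i → ∃ λ j → (i , j) ∈ H) →
                      All (λ e → Adjacent Δ (g (proj₁ e)) (g (proj₂ e))) H → ∀ i → BVert G d₀ (ι (g i))
    embedded-vertex ts spans adjacent i =
      BAdj⇒BVert (embedded-edge ts adjacent i _ (inj₁ (proj₂ (spans i))))

    contains : ∀ {Δ H g} → Injective _≡_ _≡_ ι → All Realizes Δ → (∀ i → ∃ λ j → (i , j) ∈ H) →
               Embeds Δ H g → ContainsSub (BVert G d₀) (BAdj G d₀) (EdgeRel H)
    contains {g = g} ι-inj ts spans (g-inj , adjacent) =
      ι ∘ g , g-inj ∘ ι-inj , embedded-vertex ts spans adjacent , embedded-edge ts adjacent

    isomorphic : ∀ {Δ g} → Injective _≡_ _≡_ ι → All Realizes Δ → Covers Δ d₀ → Closed Δ →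
                 IsomorphicVia Δ g → IsoTo (BVert G d₀) (BAdj G d₀) B₆
    isomorphic {g = g} ι-inj ts c₀ cl ((g-inj , adjacent) , onto , reflects) =
      ι ∘ g , g-inj ∘ ι-inj , embedded-vertex ts (hexagon-spans _) adjacent , surjective ,
      λ i j → embedded-edge ts adjacent i j , back i j
      where
      open Closure ts c₀ cl
      surjective : ∀ v → BVert G d₀ v → ∃ λ i → ι (g i) ≡ v
      surjective v bv with block-vertex bv
      ... | x , refl with onto x
      ...   | i , refl = i , refl
      back : ∀ i j → BAdj G d₀ (ι (g i)) (ι (g j)) → B₆ i j
      back i j e with block-edge e
      ... | x , y , xy , x≡ , y≡ with ι-inj x≡ | ι-inj y≡
      ...   | refl | refl = reflects i j xy

  open Labelled

  -- Soundness of the search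

  record Realization {k} (Δ : List (Triple k)) (C : List (Arc k)) : Set where
    field
      label     : Fin k → Vertex G
      injective : Injective _≡_ _≡_ label
      realized  : All (Realizes label) Δ
      anchored  : Covers label Δ d₀
      boundary  : All (λ e → NoΩDart (label (proj₂ e)) (label (proj₁ e))) C

  BlockDichotomy : Set
  BlockDichotomy = AtMost5Vertices (BVert G d₀)
                 ⊎ ContainsSub (BVert G d₀) (BAdj G d₀) Θ₆²
                   × (ContainsSub (BVert G d₀) (BAdj G d₀) Θ₆¹ ⊎ IsoTo (BVert G d₀) (BAdj G d₀) B₆)

  module _ {k} {Δ : List (Triple k)} {C : List (Arc k)} (R : Realization Δ C) where
    open Realization R

    mark-boundary : ∀ {a b} → NoΩDart (label b) (label a) → Realization Δ ((a , b) ∷ C)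
    mark-boundary none = record
      { label = label ; injective = injective ; realized = realized ; anchored = anchored
      ; boundary = none ∷ boundary }

    attach : ∀ {a b i} → Triangle (label b) (label a) (label i) → Realization ((b , a , i) ∷ Δ) C
    attach t = record
      { label = label ; injective = injective ; realized = t ∷ realized ; anchored = widen anchored
      ; boundary = boundary }
      where
      widen : ∀ {d} → Covers label Δ d → Covers label ((_ , _ , _) ∷ Δ) d
      widen (x , y , m , x-tail , y-head) = x , y , there (there (there m)) , x-tail , y-head

    attach-new : ∀ {a b w} → (∀ x → label x ≢ w) → Triangle (label b) (label a) w →
                 Realization ((suc b , suc a , zero) ∷ map shift Δ) (map shiftArc C)
    attach-new {w = w} fresh t = record
      { label     = w ∷ᶠ label
      ; injective = ∷-injective injective fresh
      ; realized  = t ∷ map⁺ realized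
      ; anchored  = shifted anchored
      ; boundary  = map⁺ boundary
      }
      where
      shift-arc : ∀ {Δ′ x y} → (x , y) ∈ arcs Δ′ → (suc x , suc y) ∈ arcs (map shift Δ′)
      shift-arc {_ ∷ _} (here refl)                 = here refl
      shift-arc {_ ∷ _} (there (here refl))         = there (here refl)
      shift-arc {_ ∷ _} (there (there (here refl))) = there (there (here refl))
      shift-arc {_ ∷ _} (there (there (there m)))   = there (there (there (shift-arc m)))
      shifted : ∀ {d} → Covers label Δ d → Covers (w ∷ᶠ label) (_ ∷ map shift Δ) d
      shifted (x , y , m , x-tail , y-head) =
        suc x , suc y , there (there (there (shift-arc m))) , x-tail , y-head

    -- A triangle of Ω sharing an arc with Δ has all its arcs in Δ, in particular (b , a).
    attachable : ∀ {a b i} → (b , a) ∉ arcs Δ → Triangle (label b) (label a) (label i) →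
                 Attachable Δ a b i
    attachable ba∉ t (inj₁ refl)             = corners-distinct (rotate t) refl
    attachable ba∉ t (inj₂ (inj₁ refl))      = corners-distinct (rotate (rotate t)) refl
    attachable ba∉ t (inj₂ (inj₂ (inj₁ m))) =
      ba∉ (covered-arc label injective t
             (covers-unrotate label realized t (covering label (rotate t) m)))
    attachable ba∉ t (inj₂ (inj₂ (inj₂ m))) =
      ba∉ (covered-arc label injective t
             (covers-unrotate label realized t
               (covers-unrotate label realized (rotate t) (covering label (rotate (rotate t)) m))))

    thetas-sound : Thetas Δ → BlockDichotomy
    thetas-sound ((_ , θ²) , (_ , θ¹)) =
      inj₂ (contains label injective realized (hexagon-spans _) θ² ,
            inj₁ (contains label injective realized (hexagon-spans _) θ¹))

    settled⇒closed : All (Settled Δ C) (arcs Δ) → Closed label Δ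
    settled⇒closed done m with All.lookup done m
    ... | inj₁ m′ = inj₁ m′
    ... | inj₂ c  = inj₂ (All.lookup boundary c)

    settled-sound : All (Settled Δ C) (arcs Δ) → SmallOrB₆ Δ → BlockDichotomy
    settled-sound done (inj₁ k≤5) =
      inj₁ (Closure.few-labels label realized anchored (settled⇒closed done) k≤5)
    settled-sound done (inj₂ ((_ , θ²) , (_ , iso))) =
      inj₂ (contains label injective realized (hexagon-spans _) θ² ,
            inj₂ (isomorphic label injective realized anchored (settled⇒closed done) iso))

  open Realization

  mutual
    search-sound : ∀ n {k} {Δ : List (Triple k)} {C} → Realization Δ C →
                   search n k Δ C ≡ true → BlockDichotomy
    search-sound (suc n) {Δ = Δ} {C} R ok with thetas? Δ
    ... | just θs = thetas-sound R θs
    ... | nothing = explore-sound n (frontier Δ C) R ok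

    explore-sound : ∀ n {k} {Δ : List (Triple k)} {C} (f : Frontier Δ C) →
                    Realization Δ C → explore n k Δ C f ≡ true → BlockDichotomy
    explore-sound n (settled done) R ok =
      settled-sound R done (to-witness-T (smallOrB₆? _) (Equivalence.from T-≡ ok))
    explore-sound n (undecided a b ab∈ ba∉) R ok =
      let ok-boundary , ok′ = ∧-true ok
          ok-new , ok-old   = ∧-true ok′
      in undecided-sound n R ab∈ ba∉ ok-boundary ok-new (allWhen-sound (attachable? _ a b) _ ok-old)

    undecided-sound : ∀ n {k} {Δ : List (Triple k)} {C a b} → Realization Δ C →
                      (a , b) ∈ arcs Δ → (b , a) ∉ arcs Δ →
                      search n k Δ ((a , b) ∷ C) ≡ true →
                      search n (suc k) ((suc b , suc a , zero) ∷ map shift Δ) (map shiftArc C) ≡ true →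
                      (∀ i → Attachable Δ a b i → search n k ((b , a , i) ∷ Δ) C ≡ true) →
                      BlockDichotomy
    undecided-sound n R ab∈ ba∉ ok-boundary ok-new ok-old with arc-triangle (label R) (realized R) ab∈
    ... | _ , _ , t with across t
    ...   | inj₁ none = search-sound n (mark-boundary R none) ok-boundary
    ...   | inj₂ (w , u) with any? (λ x → label R x ≟ w)
    ...     | no fresh       = search-sound n (attach-new R (λ x eq → fresh (x , eq)) u) ok-new
    ...     | yes (i , refl) = search-sound n (attach R u) (ok-old i (attachable R ba∉ u))

  initial : Realization triangle₀ []
  initial = record
    { label     = a ∷ᶠ b ∷ᶠ c ∷ᶠ []ᶠ
    ; injective = ∷-injective (∷-injective (∷-injective (λ { {()} }) λ ()) c-fresh) bc-fresh
    ; realized  = t₀ ∷ []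
    ; anchored  = # 0 , # 1 , here refl , refl , sym (vert-α d₀)
    ; boundary  = []
    }
    where
    a b c : Vertex G
    a = vert d₀
    b = vert (φ G d₀)
    c = vert (φ G (φ G d₀))
    t₀ : Triangle a b c
    t₀ = triangle d₀ base refl refl refl
    c-fresh : ∀ x → (c ∷ᶠ []ᶠ) x ≢ b
    c-fresh zero = corners-distinct (rotate t₀) ∘ sym
    bc-fresh : ∀ x → (b ∷ᶠ c ∷ᶠ []ᶠ) x ≢ a
    bc-fresh zero       = corners-distinct t₀ ∘ sym
    bc-fresh (suc zero) = corners-distinct (rotate (rotate t₀))

  block-dichotomy : BlockDichotomy
  block-dichotomy = search-sound 10 initial search-succeeds

  Θ₆¹-free-case : BlockDichotomy → Free (BVert G d₀) (BAdj G d₀) Θ₆¹ →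
                  AtMost5Vertices (BVert G d₀) ⊎ IsoTo (BVert G d₀) (BAdj G d₀) B₆
  Θ₆¹-free-case (inj₁ small)          _    = inj₁ small
  Θ₆¹-free-case (inj₂ (_ , inj₁ θ¹))  free = ⊥-elim (free θ¹)
  Θ₆¹-free-case (inj₂ (_ , inj₂ iso)) _    = inj₂ iso

  Θ₆²-free-case : BlockDichotomy → Free (BVert G d₀) (BAdj G d₀) Θ₆² → AtMost5Vertices (BVert G d₀)
  Θ₆²-free-case (inj₁ small)    _    = small
  Θ₆²-free-case (inj₂ (θ² , _)) free = ⊥-elim (free θ²)

lemma9 : (G : PlaneGraph) (d₀ : Dart G) → Is3Face G d₀ →
    (Free (BVert G d₀) (BAdj G d₀) Θ₆¹ →
       AtMost5Vertices (BVert G d₀) ⊎ IsoTo (BVert G d₀) (BAdj G d₀) B₆)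
    × (Free (BVert G d₀) (BAdj G d₀) Θ₆² → AtMost5Vertices (BVert G d₀))
lemma9 G d₀ t₀ = Θ₆¹-free-case G d₀ t₀ (block-dichotomy G d₀ t₀)
               , Θ₆²-free-case G d₀ t₀ (block-dichotomy G d₀ t₀)
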